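{- $E_0^\omega\le_B E_{\mathcal{S}}(E_0)$.
   Context: $E_0$ on $2^\omega$: $xE_0y$ iff $\exists n\,\forall m>n\ x(m)=y(m)$. $E_0^\omega$ on $(2^\omega)^\omega$: $xE_0^\omega y$ iff $x(n)E_0y(n)$ for all $n$. $E_{\mathcal{S}}(E_0)$ is the equivalence relation on $(2^\omega)^{\mathbb{Z}}$ with $(x_n)E_{\mathcal{S}}(E_0)(y_n)$ iff $\exists n\in\mathbb{Z}\,\forall k\in\mathbb{Z}\ x_{n+k}E_0y_k$. $\le_B$ denotes Borel reducibility. -}

module Defs where

open import Data.Bool using (Bool; true; false)
open import Data.Nat using (ℕ; _>_)
open import Data.Integer using (ℤ; _+_)
open import Data.Product using (Σ; _×_; _,_)
open import Relation.Binary.PropositionalEquality using (_≡_)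
open import Relation.Nullary using (¬_)
open import Function.Bundles using (_⇔_)

Cantor : Set
Cantor = ℕ → Bool

-- Zero-dimensional product spaces  2^C  (C a countable set of coordinates),
-- with the product topology.  The sets {x | x c ≡ true} (c : C) form a
-- countable clopen subbasis, so they generate the Borel σ-algebra.

data BorelCode (C : Set) : Set where
  atom  : C → BorelCode C
  compl : BorelCode C → BorelCode C
  union : (ℕ → BorelCode C) → BorelCode C

⟦_⟧ : {C : Set} → BorelCode C → (C → Bool) → Set
⟦ atom c ⟧ x = x c ≡ true
⟦ compl B ⟧ x = ¬ ⟦ B ⟧ x
⟦ union Bs ⟧ x = Σ ℕ (λ n → ⟦ Bs n ⟧ x)

-- f : 2^C → 2^D is Borel: the preimage of every subbasic clopen set is Borel
-- (equivalent to preimages of all Borel sets being Borel).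
IsBorel : {C D : Set} → ((C → Bool) → (D → Bool)) → Set
IsBorel {C} {D} f = (d : D) → Σ (BorelCode C) (λ B → (x : C → Bool) → (f x d ≡ true) ⇔ ⟦ B ⟧ x)

_≤B_ : {C D : Set} → ((C → Bool) → (C → Bool) → Set) → ((D → Bool) → (D → Bool) → Set) → Set
_≤B_ {C} {D} E F =
  Σ ((C → Bool) → (D → Bool)) (λ f → IsBorel f × ((x y : C → Bool) → E x y ⇔ F (f x) (f y)))

E0 : Cantor → Cantor → Set
E0 x y = Σ ℕ (λ n → (m : ℕ) → m > n → x m ≡ y m)

-- (2^ω)^ω, presented as 2^(ℕ × ℕ): x (n , m) is bit m of the n-th entry
CantorSeq : Set
CantorSeq = ℕ × ℕ → Bool

-- (2^ω)^ℤ, presented as 2^(ℤ × ℕ)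
CantorZSeq : Set
CantorZSeq = ℤ × ℕ → Bool

entry : {I : Set} → (I × ℕ → Bool) → I → Cantor
entry x i m = x (i , m)

E0ω : CantorSeq → CantorSeq → Set
E0ω x y = (n : ℕ) → E0 (entry x n) (entry y n)

ES-E0 : CantorZSeq → CantorZSeq → Set
ES-E0 x y = Σ ℤ (λ n → (k : ℤ) → E0 (entry x (n + k)) (entry y k))

{-# OPTIONS --safe #-}
module Submission where

open import Defs
open import Data.Bool using (Bool; true; false)
open import Data.Empty using (⊥-elim)
open import Data.Integer using (+_; -[1+_]; +[1+_]; _+_)
open import Data.Integer.Properties using (+-identityˡ; +-identityʳ; n⊖n≡0)
open import Data.Nat using (ℕ; zero; suc; _*_; _⊔_; _<_; s≤s)
open import Data.Nat.Properties using (*-cancelʳ-<; m≤m*n; <-≤-trans; m⊔n<o⇒m<o; m⊔n<o⇒n<o)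
open import Data.Product using (Σ; _×_; _,_)
open import Data.Sum using (_⊎_; inj₁; inj₂; map₂)
open import Function using (_∘_)
open import Function.Bundles using (_⇔_; mk⇔)
open import Relation.Binary.PropositionalEquality
  using (_≡_; refl; sym; trans; cong; subst; module ≡-Reasoning)
open import Relation.Nullary using (¬_)

-- Pad every entry with 1s at the odd positions, so that no padded entry is
-- E₀-equivalent to 0^ω, and place the padded sequence at the indices k ≥ 0 of a
-- ℤ-sequence whose entries at k < 0 are 0^ω.  A shift n witnessing E_S(E₀)
-- between two such sequences must then be 0: for n ≠ 0 it would match some
-- entry 0^ω with a padded one.  With shift 0, E_S(E₀) is just E₀ entrywise,
-- which is E₀^ω of the unpadded sequences.  The map is Borel because every
-- output bit is a constant or a copy of an input bit.

E0-refl : ∀ {s} → E0 s s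
E0-refl = 0 , λ _ _ → refl

E0-sym : ∀ {s t} → E0 s t → E0 t s
E0-sym (n , agree) = n , λ m m>n → sym (agree m m>n)

E0-trans : ∀ {s t u} → E0 s t → E0 t u → E0 s u
E0-trans (n₁ , agree₁) (n₂ , agree₂) =
  n₁ ⊔ n₂ , λ m m>n → trans (agree₁ m (m⊔n<o⇒m<o n₁ n₂ m>n)) (agree₂ m (m⊔n<o⇒n<o n₁ n₂ m>n))

zeros : Cantor
zeros _ = false

read : {C : Set} → (C → Bool) → Bool ⊎ C → Bool
read x (inj₁ b) = b
read x (inj₂ c) = x c

read-map₂ : {C D : Set} (x : D → Bool) (g : C → D) (r : Bool ⊎ C) →
            read x (map₂ g r) ≡ read (x ∘ g) r
read-map₂ x g (inj₁ b) = refl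
read-map₂ x g (inj₂ c) = refl

CopiesBits : {C D : Set} → ((C → Bool) → (D → Bool)) → Set
CopiesBits {C} {D} f = (d : D) → Σ (Bool ⊎ C) λ r → (x : C → Bool) → f x d ≡ read x r

trueCode : {C : Set} → C → BorelCode C
trueCode c = union λ { zero → atom c ; (suc _) → compl (atom c) }

⟦trueCode⟧ : {C : Set} (c : C) (x : C → Bool) → ⟦ trueCode c ⟧ x
⟦trueCode⟧ c x with x c in xc
... | true  = 0 , xc
... | false = 1 , λ xc≡true → false≢true (trans (sym xc) xc≡true)
  where
  false≢true : ¬ false ≡ true
  false≢true ()

-- Constant bits need some atom to be coded, whence the point c₀ of C.
readCode : {C : Set} → C → Bool ⊎ C → BorelCode C
readCode c₀ (inj₁ true)  = trueCode c₀
readCode c₀ (inj₁ false) = compl (trueCode c₀)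
readCode c₀ (inj₂ c)     = atom c

readCode-sound : {C : Set} (c₀ : C) (r : Bool ⊎ C) (x : C → Bool) →
                 (read x r ≡ true) ⇔ ⟦ readCode c₀ r ⟧ x
readCode-sound c₀ (inj₁ true)  x = mk⇔ (λ _ → ⟦trueCode⟧ c₀ x) (λ _ → refl)
readCode-sound c₀ (inj₁ false) x = mk⇔ (λ ()) (λ ¬full → ⊥-elim (¬full (⟦trueCode⟧ c₀ x)))
readCode-sound c₀ (inj₂ c)     x = mk⇔ (λ xc → xc) (λ xc → xc)

copiesBits⇒isBorel : {C D : Set} {f : (C → Bool) → (D → Bool)} → C → CopiesBits f → IsBorel f
copiesBits⇒isBorel c₀ copies d with copies d
... | r , fxd≡read =
  readCode c₀ r , λ x → subst (λ b → (b ≡ true) ⇔ ⟦ readCode c₀ r ⟧ x)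
                              (sym (fxd≡read x)) (readCode-sound c₀ r x)

data EvenOdd : ℕ → Set where
  even : ∀ j → EvenOdd (j * 2)
  odd  : ∀ j → EvenOdd (suc (j * 2))

evenOdd : ∀ m → EvenOdd m
evenOdd zero = even 0
evenOdd (suc zero) = odd 0
evenOdd (suc (suc m)) with evenOdd m
... | even j = even (suc j)
... | odd j  = odd (suc j)

padSource : ℕ → Bool ⊎ ℕ
padSource zero = inj₂ 0
padSource (suc zero) = inj₁ true
padSource (suc (suc m)) = map₂ suc (padSource m)

pad : Cantor → Cantor
pad s m = read s (padSource m)

padSource-even : ∀ j → padSource (j * 2) ≡ inj₂ j
padSource-even zero = refl
padSource-even (suc j) = cong (map₂ suc) (padSource-even j)

padSource-odd : ∀ j → padSource (suc (j * 2)) ≡ inj₁ true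
padSource-odd zero = refl
padSource-odd (suc j) = cong (map₂ suc) (padSource-odd j)

pad-even : ∀ s j → pad s (j * 2) ≡ s j
pad-even s j = cong (read s) (padSource-even j)

pad-odd : ∀ s j → pad s (suc (j * 2)) ≡ true
pad-odd s j = cong (read s) (padSource-odd j)

pad-E0 : ∀ {s t} → E0 s t → E0 (pad s) (pad t)
pad-E0 {s} {t} (n , agree) = n * 2 , agreePadded
  where
  open ≡-Reasoning
  agreePadded : ∀ m → n * 2 < m → pad s m ≡ pad t m
  agreePadded m m>2n with evenOdd m
  ... | even j = begin
    pad s (j * 2)  ≡⟨ pad-even s j ⟩
    s j            ≡⟨ agree j (*-cancelʳ-< 2 n j m>2n) ⟩
    t j            ≡⟨ pad-even t j ⟨
    pad t (j * 2)  ∎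
  ... | odd j = trans (pad-odd s j) (sym (pad-odd t j))

pad-E0⁻¹ : ∀ {s t} → E0 (pad s) (pad t) → E0 s t
pad-E0⁻¹ {s} {t} (n , agree) = n , λ j j>n → begin
  s j            ≡⟨ pad-even s j ⟨
  pad s (j * 2)  ≡⟨ agree (j * 2) (<-≤-trans j>n (m≤m*n j 2)) ⟩
  pad t (j * 2)  ≡⟨ pad-even t j ⟩
  t j            ∎
  where open ≡-Reasoning

pad-not-E0-zeros : ∀ s → ¬ E0 (pad s) zeros
pad-not-E0-zeros s (n , agree) with trans (sym (pad-odd s n)) (agree (suc (n * 2)) (s≤s (m≤m*n n 2)))
... | ()

NullExactlyOnNegatives : CantorZSeq → Set
NullExactlyOnNegatives u =
  (∀ a → E0 (entry u -[1+ a ]) zeros) × (∀ i → ¬ E0 (entry u (+ i)) zeros)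

shift≡0 : ∀ u v → NullExactlyOnNegatives u → NullExactlyOnNegatives v →
          ∀ n → (∀ k → E0 (entry u (n + k)) (entry v k)) → n ≡ + 0
shift≡0 _ _ _ _ (+ zero) _ = refl
shift≡0 u v (_ , u-nonNull) (v-null , _) +[1+ a ] shifted =
  ⊥-elim (u-nonNull 0 (E0-trans u₀~v (v-null a)))
  where
  u₀~v : E0 (entry u (+ 0)) (entry v -[1+ a ])
  u₀~v = subst (λ k → E0 (entry u k) (entry v -[1+ a ])) (n⊖n≡0 (suc a)) (shifted -[1+ a ])
shift≡0 u v (u-null , _) (_ , v-nonNull) -[1+ a ] shifted =
  ⊥-elim (v-nonNull 0 (E0-trans (E0-sym u~v₀) (u-null a)))
  where
  u~v₀ : E0 (entry u -[1+ a ]) (entry v (+ 0))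
  u~v₀ = subst (λ k → E0 (entry u k) (entry v (+ 0))) (+-identityʳ -[1+ a ]) (shifted (+ 0))

ES-E0⇒entrywise : ∀ u v → NullExactlyOnNegatives u → NullExactlyOnNegatives v →
                  ES-E0 u v → ∀ k → E0 (entry u k) (entry v k)
ES-E0⇒entrywise u v u-null v-null (n , shifted) k with shift≡0 u v u-null v-null n shifted
... | refl = subst (λ k′ → E0 (entry u k′) (entry v k)) (+-identityˡ k) (shifted k)

entrywise⇒ES-E0 : ∀ {u v} → (∀ k → E0 (entry u k) (entry v k)) → ES-E0 u v
entrywise⇒ES-E0 {u} {v} entrywise =
  + 0 , λ k → subst (λ k′ → E0 (entry u k′) (entry v k)) (sym (+-identityˡ k)) (entrywise k)

embed : CantorSeq → CantorZSeq
embed x (+ i , m) = pad (entry x i) m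
embed x (-[1+ _ ] , _) = false

embed-copiesBits : CopiesBits embed
embed-copiesBits (+ i , m) = map₂ (i ,_) (padSource m) , λ x → sym (read-map₂ x (i ,_) (padSource m))
embed-copiesBits (-[1+ _ ] , _) = inj₁ false , λ _ → refl

embed-nullExactlyOnNegatives : ∀ x → NullExactlyOnNegatives (embed x)
embed-nullExactlyOnNegatives x = (λ _ → E0-refl) , (λ i → pad-not-E0-zeros (entry x i))

embed-entrywise : ∀ {x y} → E0ω x y → ∀ k → E0 (entry (embed x) k) (entry (embed y) k)
embed-entrywise x~y (+ i) = pad-E0 (x~y i)
embed-entrywise x~y -[1+ _ ] = E0-refl

proposition2p16 : E0ω ≤B ES-E0
proposition2p16 =
  embed , copiesBits⇒isBorel (0 , 0) embed-copiesBits , λ x y → mk⇔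
    (λ x~y → entrywise⇒ES-E0 (embed-entrywise x~y))
    (λ ex~ey i → pad-E0⁻¹ (ES-E0⇒entrywise (embed x) (embed y)
                                             (embed-nullExactlyOnNegatives x)
                                             (embed-nullExactlyOnNegatives y) ex~ey (+ i)))
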